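{- Let $n, b$ be odd integers with $3 \leq b \leq n/3$, and let $\mu \geq 2$ be an integer. Let $I \geq 1$ and $d \in [0, b-1]$ be the unique integers with $n = 2bI + b + 2d$. Let $t_0 \in \Omega^b_\mu(b+d)$ and $t_i \in \Omega^b_\mu(b)$ for $1 \leq i \leq 2I$. Then there exist $\mu$ transversals of $B_n$ that intersect stably in $t = d + \sum_{i=0}^{2I} t_i$ points.
   Context: For integers $a \le b$, $[a,b] = \{a, \ldots, b\}$. Rows, columns and symbols are indexed by $[0,n-1]$ and taken modulo $n$; $B_n = \{(r,c,r+c \bmod n) : r,c \in [0,n-1]\}$ (triples $(r,c,e)$ mean cell $(r,c)$ contains symbol $e$). A transversal of $B_n$ is a set of $n$ triples of $B_n$ containing each row, each column and each symbol exactly once. A collection of $\mu$ sets of triples $T_1,\ldots,T_\mu$ intersects stably in $t$ points if, with $S=\bigcap_{i=1}^\mu T_i$, $|S|=t$ and $(T_i\cap T_j)\setminus S=\emptyset$ for all $1\le i<j\le\mu$. For $0 \le j \le n$, $B_{0,j}$ denotes the $j\times j$ subsquare of $B_n$ on rows and columns $[0,j-1]$; a partial transversal of $B_{0,j}$ is a set of $j$ triples of $B_n$ whose rows and columns lie in $[0,j-1]$, with the $j$ rows pairwise distinct, the $j$ columns pairwise distinct and the $j$ symbols pairwise distinct. For fixed $n$, $\mu$ and odd $b$ with $3 \le b \le n/3$, and an integer $\bar d \ge 0$, $\Omega^b_\mu(b+\bar d)$ denotes the set of integers $t$ such that there exist $\mu$ partial transversals of $B_{0,b+\bar d}$ (within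 $B_n$) that intersect stably in $t$ points and use only symbols from $[(b-1)/2,\, 3(b-1)/2 + 2\bar d] \setminus \{b+2j : 0 \le j < \bar d\}$. -}

module Defs where

open import Data.Nat using (ℕ; zero; suc; _+_; _*_; _∸_; _<_; _≤_; NonZero)
open import Data.Nat.DivMod using (_/_; _%_)
open import Data.Fin as Fin using (Fin)
open import Data.Product using (Σ; ∃; _×_; _,_; proj₁; proj₂)
open import Data.List using (List; length; map)
open import Data.List.Membership.Propositional using (_∈_)
open import Data.List.Relation.Unary.All using (All)
open import Data.List.Relation.Unary.Unique.Propositional using (Unique)
open import Relation.Binary.PropositionalEquality using (_≡_)
open import Relation.Nullary using (¬_)
open import Function.Bundles using (_⇔_)

Triple : Set
Triple = ℕ × ℕ × ℕ

row col sym : Triple → ℕ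
row (r , c , e) = r
col (r , c , e) = c
sym (r , c , e) = e

InB : (n : ℕ) → .{{NonZero n}} → Triple → Set
InB n (r , c , e) = r < n × c < n × e ≡ (r + c) % n

ExactlyOnce : (Triple → ℕ) → List Triple → ℕ → Set
ExactlyOnce f T v =
  (Σ Triple λ x → x ∈ T × f x ≡ v) ×
  (∀ x y → x ∈ T → y ∈ T → f x ≡ v → f y ≡ v → x ≡ y)

Transversal : (n : ℕ) → .{{NonZero n}} → List Triple → Set
Transversal n T =
  Unique T × length T ≡ n × All (InB n) T ×
  (∀ v → v < n →
     ExactlyOnce row T v × ExactlyOnce col T v × ExactlyOnce sym T v)

PartialTransversal : (n : ℕ) → .{{NonZero n}} → ℕ → List Triple → Set
PartialTransversal n j T =
  length T ≡ j × All (InB n) T ×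
  All (λ x → row x < j × col x < j) T ×
  Unique (map row T) × Unique (map col T) × Unique (map sym T)

StablyIntersect : (μ : ℕ) → (Fin μ → List Triple) → ℕ → Set
StablyIntersect μ T t =
  Σ (List Triple) λ S →
    Unique S ×
    (∀ x → (x ∈ S) ⇔ (∀ i → x ∈ T i)) ×
    length S ≡ t ×
    (∀ i j → i Fin.< j → ∀ x → x ∈ T i → x ∈ T j → x ∈ S)

AllowedSym : ℕ → ℕ → ℕ → Set
AllowedSym b dbar e =
  (b ∸ 1) / 2 ≤ e × e ≤ (3 * (b ∸ 1)) / 2 + 2 * dbar ×
  (∀ j → j < dbar → ¬ (e ≡ b + 2 * j))

InOmega : (n : ℕ) → .{{NonZero n}} → (μ b dbar t : ℕ) → Set
InOmega n μ b dbar t =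
  Σ (Fin μ → List Triple) λ T →
    (∀ i → PartialTransversal n (b + dbar) (T i)) ×
    (∀ i → All (λ x → AllowedSym b dbar (sym x)) (T i)) ×
    StablyIntersect μ T t

Odd : ℕ → Set
Odd m = ∃ λ k → m ≡ 2 * k + 1

-- Cut B_n along the diagonal into consecutive square windows: a (b+d)-square carrying the
-- given partial transversals for t_0, then I squares of side b, a d×d diagonal strip, and
-- I more squares of side b.  Copying a partial transversal of B_{0,b} into the square with
-- corner (o, o) adds 2o to every symbol, and the corners are chosen so that modulo n the 2I
-- blocks receive the pairwise disjoint symbol windows [(b-1)/2 + 2d + c b, 3(b-1)/2 + 2d + c b]
-- for c = 1, …, 2I, all above the symbols used by the first square.  The diagonal strip
-- contributes exactly the symbols b + 2j excluded from the first square, so every row, column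
-- and symbol is used once; since the strip is common to all μ transversals, the pieces
-- intersect stably in d + t_0 + … + t_{2I} points.
module Submission where

open import Defs
open import Data.Nat using (ℕ; zero; suc; _+_; _*_; _∸_; _<_; _≤_; NonZero; z≤n; s≤s; _<?_)
open import Data.Nat.Properties
open import Data.Nat.DivMod using (_/_; _%_; m≡m%n+[m/n]*n; m%n<n; m<n⇒m%n≡m; [m+n]%n≡m%n; m*n/n≡m)
open import Data.Nat.ListAction using (sum)
open import Data.Nat.Tactic.RingSolver using (solve-∀)
open import Data.Fin as Fin using (Fin; toℕ)
open import Data.Fin.Properties using (toℕ<n; toℕ-injective)
open import Data.List using (List; []; _∷_; _++_; map; concat; length; upTo; applyUpTo; tabulate)
open import Data.List.Properties
  using (length-++; length-map; length-upTo; length-applyUpTo; length-removeAt′; map-tabulate; map-applyUpTo)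
open import Data.List.Relation.Unary.All as All using (All; []; _∷_)
import Data.List.Relation.Unary.All.Properties as Allₚ
open import Data.List.Relation.Unary.AllPairs as AllPairs using (AllPairs; []; _∷_)
import Data.List.Relation.Unary.AllPairs.Properties as AllPairsₚ
open import Data.List.Relation.Unary.Any using (here; there; index; _─_)
open import Data.List.Relation.Unary.Unique.Propositional using (Unique)
import Data.List.Relation.Unary.Unique.Propositional.Properties as Uniqueₚ
open import Data.List.Membership.Propositional using (_∈_)
open import Data.List.Membership.Propositional.Properties
  using (∈-++⁺ˡ; ∈-++⁺ʳ; ∈-++⁻; ∈-map⁺; ∈-map⁻; ∈-upTo⁺; ∈-concat⁻′)
open import Data.List.Membership.DecPropositional Data.Nat._≟_ using (_∈?_)
open import Data.Product using (Σ; ∃; _×_; _,_; proj₁; proj₂)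
open import Data.Sum using (_⊎_; inj₁; inj₂)
open import Data.Empty using (⊥; ⊥-elim)
open import Function using (_∘_)
open import Function.Bundles using (mk⇔; Equivalence)
open import Relation.Nullary using (¬_; yes; no)
open import Relation.Binary.PropositionalEquality as ≡
  using (_≡_; _≢_; refl; cong; cong₂; subst; trans)
open import Relation.Binary.Definitions using (tri<; tri≈; tri>)

Distinct : {A B : Set} → (A → B) → List A → Set
Distinct f = AllPairs (λ x y → f x ≢ f y)

distinct-∈ : ∀ {A B : Set} {f : A → B} {xs x y} →
  Distinct f xs → x ∈ xs → y ∈ xs → f x ≡ f y → x ≡ y
distinct-∈ (_ ∷ _) (here refl) (here refl) _ = refl
distinct-∈ (fx≢ ∷ _) (here refl) (there y∈) eq = ⊥-elim (All.lookup fx≢ y∈ eq)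
distinct-∈ (fy≢ ∷ _) (there x∈) (here refl) eq = ⊥-elim (All.lookup fy≢ x∈ (≡.sym eq))
distinct-∈ (_ ∷ dist) (there x∈) (there y∈) eq = distinct-∈ dist x∈ y∈ eq

AllPairs-mapOn : ∀ {A : Set} {Q : A → Set} {R S : A → A → Set} {xs} →
  (∀ {x y} → Q x → Q y → R x y → S x y) → All Q xs → AllPairs R xs → AllPairs S xs
AllPairs-mapOn f [] [] = []
AllPairs-mapOn f (qx ∷ qs) (rx ∷ rs) =
  All.zipWith (λ (qy , r) → f qx qy r) (qs , rx) ∷ AllPairs-mapOn f qs rs

∈-─ : ∀ {A : Set} {x z : A} {ys} (x∈ys : x ∈ ys) → z ∈ ys → z ≢ x → z ∈ (ys ─ x∈ys)
∈-─ (here refl) (here refl) z≢x = ⊥-elim (z≢x refl)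
∈-─ (here _) (there z∈) _ = z∈
∈-─ (there _) (here refl) _ = here refl
∈-─ (there x∈) (there z∈) z≢x = there (∈-─ x∈ z∈ z≢x)

unique-⊆⇒length≤ : ∀ {A : Set} {xs ys : List A} → Unique xs → All (_∈ ys) xs → length xs ≤ length ys
unique-⊆⇒length≤ [] [] = z≤n
unique-⊆⇒length≤ {xs = _ ∷ xs} {ys} (x≢xs ∷ u) (x∈ys ∷ xs⊆ys) = begin
  suc (length xs)           ≤⟨ s≤s (unique-⊆⇒length≤ u xs⊆ys─x) ⟩
  suc (length (ys ─ x∈ys))  ≡⟨ length-removeAt′ ys (index x∈ys) ⟨
  length ys                 ∎
  where
  open ≤-Reasoning
  xs⊆ys─x : All (λ z → z ∈ (ys ─ x∈ys)) xs
  xs⊆ys─x = All.zipWith (λ (x≢z , z∈ys) → ∈-─ x∈ys z∈ys (x≢z ∘ ≡.sym)) (x≢xs , xs⊆ys)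

unique-full⇒∈ : ∀ {n v} {xs : List ℕ} → Unique xs → All (_< n) xs → length xs ≡ n → v < n → v ∈ xs
unique-full⇒∈ {n} {v} {xs} u xs<n |xs|≡n v<n with v ∈? xs
... | yes v∈xs = v∈xs
... | no v∉xs = ⊥-elim (1+n≰n (begin
  suc n              ≡⟨ cong suc |xs|≡n ⟨
  length (v ∷ xs)    ≤⟨ unique-⊆⇒length≤ (v≢xs ∷ u) (∈-upTo⁺ v<n ∷ All.map ∈-upTo⁺ xs<n) ⟩
  length (upTo n)    ≡⟨ length-upTo n ⟩
  n                  ∎))
  where
  open ≤-Reasoning
  v≢xs : All (v ≢_) xs
  v≢xs = All.tabulate λ z∈xs v≡z → v∉xs (subst (_∈ xs) (≡.sym v≡z) z∈xs)

exactlyOnce : ∀ {n} (f : Triple → ℕ) {T} →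
  Distinct f T → All (λ x → f x < n) T → length T ≡ n → ∀ {v} → v < n → ExactlyOnce f T v
exactlyOnce f {T} dist f<n |T|≡n v<n
  with x , x∈T , v≡fx ← ∈-map⁻ f (unique-full⇒∈ (AllPairsₚ.map⁺ dist) (Allₚ.map⁺ f<n)
                                    (trans (length-map f T) |T|≡n) v<n)
  = (x , x∈T , ≡.sym v≡fx) ,
    λ y z y∈T z∈T fy≡v fz≡v → distinct-∈ dist y∈T z∈T (trans fy≡v (≡.sym fz≡v))

InB⇒sym<n : ∀ {n} .{{_ : NonZero n}} {x} → InB n x → sym x < n
InB⇒sym<n {n} {r , c , _} (_ , _ , refl) = m%n<n (r + c) n

transversal : ∀ {n} .{{_ : NonZero n}} {T} → length T ≡ n → All (InB n) T →
  Distinct row T → Distinct col T → Distinct sym T → Transversal n T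
transversal |T|≡n inB rows cols syms =
  AllPairs.map (λ r≢ → r≢ ∘ cong row) rows , |T|≡n , inB ,
  λ v v<n → exactlyOnce row rows (All.map proj₁ inB) |T|≡n v<n ,
            exactlyOnce col cols (All.map (proj₁ ∘ proj₂) inB) |T|≡n v<n ,
            exactlyOnce sym syms (All.map InB⇒sym<n inB) |T|≡n v<n

tabulate-toℕ : ∀ {A : Set} n (f : ℕ → A) → tabulate {n = n} (f ∘ toℕ) ≡ applyUpTo f n
tabulate-toℕ zero f = refl
tabulate-toℕ (suc n) f = cong (f 0 ∷_) (tabulate-toℕ n (f ∘ suc))

sum-applyUpTo-const : ∀ m c → sum (applyUpTo (λ _ → c) m) ≡ m * c
sum-applyUpTo-const zero c = refl
sum-applyUpTo-const (suc m) c = cong (c +_) (sum-applyUpTo-const m c)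

-- Stable intersections

Family : ℕ → Set
Family μ = Fin μ → List Triple

Apart : ∀ {μ} → Family μ → Family μ → Set
Apart F G = ∀ i j {x} → x ∈ F i → x ∈ G j → ⊥

module _ {μ : ℕ} (i₀ : Fin μ) where
  open Equivalence using (to; from)

  stablyIntersect-const : ∀ {xs t} → Unique xs → length xs ≡ t → StablyIntersect μ (λ _ → xs) t
  stablyIntersect-const {xs} u |xs|≡t =
    xs , u , (λ x → mk⇔ (λ x∈xs _ → x∈xs) (λ x∈all → x∈all i₀)) , |xs|≡t , λ _ _ _ _ x∈xs _ → x∈xs

  stablyIntersect-++ : ∀ {F G s t} → Apart F G →
    StablyIntersect μ F s → StablyIntersect μ G t → StablyIntersect μ (λ i → F i ++ G i) (s + t)
  stablyIntersect-++ {F} {G} apart (S , uS , S⇔ , |S| , stS) (S′ , uS′ , S′⇔ , |S′| , stS′) =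
    S ++ S′ , Uniqueₚ.++⁺ uS uS′ disjoint , (λ x → mk⇔ (spread x) (collect x)) ,
    trans (length-++ S) (cong₂ _+_ |S| |S′|) , stable
    where
    disjoint : ∀ {x} → ¬ (x ∈ S × x ∈ S′)
    disjoint {x} (x∈S , x∈S′) = apart i₀ i₀ (to (S⇔ x) x∈S i₀) (to (S′⇔ x) x∈S′ i₀)
    stayˡ : ∀ {i j x} → x ∈ F i → x ∈ F j ++ G j → x ∈ F j
    stayˡ {j = j} x∈Fi x∈ with ∈-++⁻ (F j) x∈
    ... | inj₁ x∈Fj = x∈Fj
    ... | inj₂ x∈Gj = ⊥-elim (apart _ _ x∈Fi x∈Gj)
    stayʳ : ∀ {i j x} → x ∈ G i → x ∈ F j ++ G j → x ∈ G j
    stayʳ {j = j} x∈Gi x∈ with ∈-++⁻ (F j) x∈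
    ... | inj₁ x∈Fj = ⊥-elim (apart _ _ x∈Fj x∈Gi)
    ... | inj₂ x∈Gj = x∈Gj
    spread : ∀ x → x ∈ S ++ S′ → ∀ i → x ∈ F i ++ G i
    spread x x∈ i with ∈-++⁻ S x∈
    ... | inj₁ x∈S = ∈-++⁺ˡ (to (S⇔ x) x∈S i)
    ... | inj₂ x∈S′ = ∈-++⁺ʳ (F i) (to (S′⇔ x) x∈S′ i)
    collect : ∀ x → (∀ i → x ∈ F i ++ G i) → x ∈ S ++ S′
    collect x x∈all with ∈-++⁻ (F i₀) (x∈all i₀)
    ... | inj₁ x∈F = ∈-++⁺ˡ (from (S⇔ x) λ i → stayˡ x∈F (x∈all i))
    ... | inj₂ x∈G = ∈-++⁺ʳ S (from (S′⇔ x) λ i → stayʳ x∈G (x∈all i))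
    stable : ∀ i j → i Fin.< j → ∀ x → x ∈ F i ++ G i → x ∈ F j ++ G j → x ∈ S ++ S′
    stable i j i<j x x∈i x∈j with ∈-++⁻ (F i) x∈i
    ... | inj₁ x∈Fi = ∈-++⁺ˡ (stS i j i<j x x∈Fi (stayˡ x∈Fi x∈j))
    ... | inj₂ x∈Gi = ∈-++⁺ʳ S (stS′ i j i<j x x∈Gi (stayʳ x∈Gi x∈j))

  stablyIntersect-map : ∀ {Q : Triple → Set} {F t} (f : Triple → Triple) →
    (∀ {x y} → Q x → Q y → f x ≡ f y → x ≡ y) → (∀ i → All Q (F i)) →
    StablyIntersect μ F t → StablyIntersect μ (λ i → map f (F i)) t
  stablyIntersect-map {Q} {F} f f-inj Q-F (S , uS , S⇔ , |S| , stS) =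
    map f S , AllPairsₚ.map⁺ (AllPairs-mapOn (λ qx qy x≢y → x≢y ∘ f-inj qx qy) Q-S uS) ,
    (λ x → mk⇔ (spread x) (collect x)) , trans (length-map f S) |S| , stable
    where
    Q-S : All Q S
    Q-S = All.tabulate λ {x} x∈S → All.lookup (Q-F i₀) (to (S⇔ x) x∈S i₀)
    pull : ∀ {i j y} → y ∈ F i → f y ∈ map f (F j) → y ∈ F j
    pull {i} {j} y∈Fi fy∈ with y′ , y′∈Fj , fy≡fy′ ← ∈-map⁻ f fy∈ =
      subst (_∈ F j) (≡.sym (f-inj (All.lookup (Q-F i) y∈Fi) (All.lookup (Q-F j) y′∈Fj) fy≡fy′)) y′∈Fj
    spread : ∀ x → x ∈ map f S → ∀ i → x ∈ map f (F i)
    spread x x∈ i with y , y∈S , refl ← ∈-map⁻ f x∈ = ∈-map⁺ f (to (S⇔ y) y∈S i)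
    collect : ∀ x → (∀ i → x ∈ map f (F i)) → x ∈ map f S
    collect x x∈all with y , y∈F₀ , refl ← ∈-map⁻ f (x∈all i₀) =
      ∈-map⁺ f (from (S⇔ y) λ i → pull y∈F₀ (x∈all i))
    stable : ∀ i j → i Fin.< j → ∀ x → x ∈ map f (F i) → x ∈ map f (F j) → x ∈ map f S
    stable i j i<j x x∈i x∈j with y , y∈Fi , refl ← ∈-map⁻ f x∈i =
      ∈-map⁺ f (stS i j i<j y y∈Fi (pull y∈Fi x∈j))

-- Windows of consecutive integers

InWindow : ℕ → ℕ → ℕ → Set
InWindow o w v = o ≤ v × v < o + w

windows-separated : ∀ {o w o′ w′ u v} → o + w ≤ o′ ⊎ o′ + w′ ≤ o →
  InWindow o w u → InWindow o′ w′ v → u ≢ v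
windows-separated (inj₁ ≤o′) (_ , u<) (o′≤v , _) refl = <⇒≢ (<-≤-trans u< (≤-trans ≤o′ o′≤v)) refl
windows-separated (inj₂ ≤o) (o≤u , _) (_ , v<) refl = <⇒≢ (<-≤-trans v< (≤-trans ≤o o≤u)) refl

InWindow-+ʳ : ∀ {c w v} o → InWindow c w v → InWindow (c + o) w (v + o)
InWindow-+ʳ {c} {w} {v} o (c≤v , v<c+w) =
  +-monoˡ-≤ o c≤v , subst (v + o <_) (+-right-comm c w o) (+-monoˡ-< o v<c+w)
  where
  +-right-comm : ∀ c w o → c + w + o ≡ c + o + w
  +-right-comm = solve-∀

window-quotient-< : ∀ {L w e e′ x y} → InWindow L w e → InWindow L w e′ → x < y → e + x * w < e′ + y * w
window-quotient-< {L} {w} {e} {e′} {x} {y} (_ , e<) (L≤e′ , _) x<y = begin-strict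
  e + x * w      <⟨ +-monoˡ-< (x * w) e< ⟩
  L + w + x * w  ≡⟨ +-assoc L w (x * w) ⟩
  L + suc x * w  ≤⟨ +-mono-≤ L≤e′ (*-monoˡ-≤ w x<y) ⟩
  e′ + y * w     ∎
  where open ≤-Reasoning

window-quotient-unique : ∀ {L w e e′ x y} → InWindow L w e → InWindow L w e′ →
  e + x * w ≡ e′ + y * w → x ≡ y
window-quotient-unique {x = x} {y} e∈ e′∈ eq with <-cmp x y
... | tri< x<y _ _ = ⊥-elim (<⇒≢ (window-quotient-< e∈ e′∈ x<y) eq)
... | tri≈ _ x≡y _ = x≡y
... | tri> _ _ y<x = ⊥-elim (<⇒≢ (window-quotient-< e′∈ e∈ y<x) (≡.sym eq))

%-injective-window : ∀ {L n u v} .{{_ : NonZero n}} →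
  InWindow L n u → InWindow L n v → u % n ≡ v % n → u ≡ v
%-injective-window {L} {n} {u} {v} u∈ v∈ eq = begin
  u                  ≡⟨ m≡m%n+[m/n]*n u n ⟩
  u % n + u / n * n  ≡⟨ cong₂ (λ r q → r + q * n) eq u/n≡v/n ⟩
  v % n + v / n * n  ≡⟨ m≡m%n+[m/n]*n v n ⟨
  v                  ∎
  where
  open ≡.≡-Reasoning
  u/n≡v/n : u / n ≡ v / n
  u/n≡v/n = window-quotient-unique v∈ u∈ exchange
    where
    exchange : v + u / n * n ≡ u + v / n * n
    exchange = begin
      v + u / n * n                    ≡⟨ cong (_+ u / n * n) (m≡m%n+[m/n]*n v n) ⟩
      v % n + v / n * n + u / n * n    ≡⟨ +-assoc (v % n) _ _ ⟩
      v % n + (v / n * n + u / n * n)  ≡⟨ cong₂ _+_ (≡.sym eq) (+-comm (v / n * n) _) ⟩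
      u % n + (u / n * n + v / n * n)  ≡⟨ +-assoc (u % n) _ _ ⟨
      u % n + u / n * n + v / n * n    ≡⟨ cong (_+ v / n * n) (m≡m%n+[m/n]*n u n) ⟨
      u + v / n * n                    ∎

-- Pieces of a transversal

InSquare : ℕ → ℕ → Triple → Set
InSquare o w x = InWindow o w (row x) × InWindow o w (col x)

record Piece (μ : ℕ) : Set where
  constructor piece
  field
    cells  : Family μ
    corner : ℕ
    size   : ℕ
    common : ℕ
open Piece

record Placed (n : ℕ) .{{_ : NonZero n}} {μ} (p : Piece μ) : Set where
  field
    length≡size  : ∀ i → length (cells p i) ≡ size p
    inB          : ∀ i → All (InB n) (cells p i)
    inSquare     : ∀ i → All (InSquare (corner p) (size p)) (cells p i)
    rowsDistinct : ∀ i → Distinct row (cells p i)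
    colsDistinct : ∀ i → Distinct col (cells p i)
    stable       : StablyIntersect μ (cells p) (common p)

Separated : ∀ {μ} → Piece μ → Piece μ → Set
Separated p q = corner p + size p ≤ corner q ⊎ corner q + size q ≤ corner p

glue : ∀ {μ} → List (Piece μ) → Family μ
glue ps i = concat (map (λ p → cells p i) ps)

module _ {n μ : ℕ} .{{_ : NonZero n}} where
  open Placed

  glue-length : ∀ {ps : List (Piece μ)} → All (Placed n) ps → ∀ i → length (glue ps i) ≡ sum (map size ps)
  glue-length [] i = refl
  glue-length {p ∷ _} (pl ∷ pls) i =
    trans (length-++ (cells p i)) (cong₂ _+_ (length≡size pl i) (glue-length pls i))

  glue-inB : ∀ {ps : List (Piece μ)} → All (Placed n) ps → ∀ i → All (InB n) (glue ps i)
  glue-inB pls i = Allₚ.concat⁺ (Allₚ.map⁺ (All.map (λ pl → inB pl i) pls))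

  glue-distinct : (f : Triple → ℕ) → (∀ {o w x} → InSquare o w x → InWindow o w (f x)) →
    (∀ {p} → Placed n p → ∀ i → Distinct f (cells p i)) →
    ∀ {ps} → All (Placed n) ps → AllPairs (Separated {μ}) ps → ∀ i → Distinct f (glue ps i)
  glue-distinct f f∈ distinct pls seps i =
    AllPairsₚ.concat⁺ (Allₚ.map⁺ (All.map (λ pl → distinct pl i) pls))
                      (AllPairsₚ.map⁺ (AllPairs-mapOn apart pls seps))
    where
    apart : ∀ {p q} → Placed n p → Placed n q → Separated p q →
      All (λ x → All (λ y → f x ≢ f y) (cells q i)) (cells p i)
    apart plp plq sep = All.map (λ x∈ → All.map (λ y∈ → windows-separated sep (f∈ x∈) (f∈ y∈))
                                                 (inSquare plq i))
                                (inSquare plp i)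

  glue-stablyIntersect : Fin μ → ∀ {ps} → All (Placed n) ps → AllPairs Separated ps →
    StablyIntersect μ (glue ps) (sum (map common ps))
  glue-stablyIntersect i₀ [] [] = stablyIntersect-const i₀ [] refl
  glue-stablyIntersect i₀ {p ∷ ps} (pl ∷ pls) (sep ∷ seps) =
    stablyIntersect-++ i₀ apart (stable pl) (glue-stablyIntersect i₀ pls seps)
    where
    apart : Apart (cells p) (glue ps)
    apart i j x∈p x∈glue
      with cs , x∈cs , cs∈ ← ∈-concat⁻′ (map (λ q → cells q j) ps) x∈glue
      with q , q∈ps , refl ← ∈-map⁻ (λ q → cells q j) cs∈
      = windows-separated (All.lookup sep q∈ps) (proj₁ (All.lookup (inSquare pl i) x∈p))
          (proj₁ (All.lookup (inSquare (All.lookup pls q∈ps) j) x∈cs)) refl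

  glue-transversal : ∀ {ps : List (Piece μ)} → All (Placed n) ps → AllPairs Separated ps →
    sum (map size ps) ≡ n → (∀ i → Distinct sym (glue ps i)) → ∀ i → Transversal n (glue ps i)
  glue-transversal pls seps sizes≡n syms i =
    transversal (trans (glue-length pls i) sizes≡n) (glue-inB pls i)
      (glue-distinct row proj₁ rowsDistinct pls seps i)
      (glue-distinct col proj₂ colsDistinct pls seps i)
      (syms i)

-- Placing cells of B_n

module Placement (n : ℕ) .{{_ : NonZero n}} where

  cell : ℕ → ℕ → Triple
  cell r c = r , c , (r + c) % n

  shift : ℕ → Triple → Triple
  shift o x = cell (row x + o) (col x + o)

  shift-injective : ∀ o {x y} → InB n x → InB n y → shift o x ≡ shift o y → x ≡ y
  shift-injective o {r , c , _} {r′ , c′ , _} (_ , _ , refl) (_ , _ , refl) eq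
    with refl ← +-cancelʳ-≡ o r r′ (cong row eq) | refl ← +-cancelʳ-≡ o c c′ (cong col eq) = refl

  sym-shift : ∀ o {y} → InB n y → row y + col y < n → sym (shift o y) ≡ (sym y + 2 * o) % n
  sym-shift o {r , c , _} (_ , _ , refl) r+c<n = cong (_% n) (begin
    r + o + (c + o)     ≡⟨ regroup r c o ⟩
    r + c + 2 * o       ≡⟨ cong (_+ 2 * o) (m<n⇒m%n≡m r+c<n) ⟨
    (r + c) % n + 2 * o ∎)
    where
    open ≡.≡-Reasoning
    regroup : ∀ r c o → r + o + (c + o) ≡ r + c + 2 * o
    regroup = solve-∀

  shiftPiece : ∀ {μ} → ℕ → Piece μ → Piece μ
  shiftPiece o p = piece (λ i → map (shift o) (cells p i)) (corner p + o) (size p) (common p)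

  shiftPiece-placed : ∀ {μ} o {p : Piece μ} → Fin μ → corner p + o + size p ≤ n →
    Placed n p → Placed n (shiftPiece o p)
  shiftPiece-placed o {p} i₀ fits pl = record
    { length≡size  = λ i → trans (length-map (shift o) (cells p i)) (length≡size i)
    ; inB          = λ i → Allₚ.map⁺ (All.map (λ (r∈ , c∈) → below-n r∈ , below-n c∈ , refl)
                                              (inSquare i))
    ; inSquare     = λ i → Allₚ.map⁺ (All.map (λ (r∈ , c∈) → InWindow-+ʳ o r∈ , InWindow-+ʳ o c∈)
                                              (inSquare i))
    ; rowsDistinct = λ i → AllPairsₚ.map⁺ (AllPairs.map (λ r≢ → r≢ ∘ +-cancelʳ-≡ o _ _) (rowsDistinct i))
    ; colsDistinct = λ i → AllPairsₚ.map⁺ (AllPairs.map (λ c≢ → c≢ ∘ +-cancelʳ-≡ o _ _) (colsDistinct i))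
    ; stable       = stablyIntersect-map i₀ (shift o) (shift-injective o) inB stable
    }
    where
    open Placed pl
    below-n : ∀ {v} → InWindow (corner p) (size p) v → v + o < n
    below-n v∈ = <-≤-trans (proj₂ (InWindow-+ʳ o v∈)) fits

  partialTransversal-unique : ∀ {w T} → PartialTransversal n w T → Unique T
  partialTransversal-unique (_ , _ , _ , rows , _) =
    AllPairs.map (λ r≢ → r≢ ∘ cong row) (AllPairsₚ.map⁻ rows)

  partialTransversal-placed : ∀ {μ w t} {F : Family μ} → (∀ i → PartialTransversal n w (F i)) →
    StablyIntersect μ F t → Placed n (piece F 0 w t)
  partialTransversal-placed pt st = record
    { length≡size  = λ i → let (|T| , _) = pt i in |T|
    ; inB          = λ i → let (_ , inB , _) = pt i in inB
    ; inSquare     = λ i → let (_ , _ , rc , _) = pt i in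
                           All.map (λ (r< , c<) → (z≤n , r<) , (z≤n , c<)) rc
    ; rowsDistinct = λ i → let (_ , _ , _ , rows , _) = pt i in AllPairsₚ.map⁻ rows
    ; colsDistinct = λ i → let (_ , _ , _ , _ , cols , _) = pt i in AllPairsₚ.map⁻ cols
    ; stable       = st
    }

  diagonal : ℕ → List Triple
  diagonal d = applyUpTo (λ j → cell j j) d

  diagonal-partialTransversal : ∀ {d} → d + d ≤ n → PartialTransversal n d (diagonal d)
  diagonal-partialTransversal {d} d+d≤n =
    length-applyUpTo _ d ,
    Allₚ.applyUpTo⁺₁ _ d (λ j<d → <n j<d , <n j<d , refl) ,
    Allₚ.applyUpTo⁺₁ _ d (λ j<d → j<d , j<d) ,
    AllPairsₚ.map⁺ (AllPairsₚ.applyUpTo⁺₁ _ d (λ i<j _ → <⇒≢ i<j)) ,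
    AllPairsₚ.map⁺ (AllPairsₚ.applyUpTo⁺₁ _ d (λ i<j _ → <⇒≢ i<j)) ,
    AllPairsₚ.map⁺ (AllPairsₚ.applyUpTo⁺₁ _ d (λ i<j j<d eq → <⇒≢ (+-mono-< i<j i<j)
      (trans (≡.sym (m<n⇒m%n≡m (+<n (<-trans i<j j<d)))) (trans eq (m<n⇒m%n≡m (+<n j<d))))))
    where
    +<n : ∀ {j} → j < d → j + j < n
    +<n j<d = <-≤-trans (+-mono-< j<d j<d) d+d≤n
    <n : ∀ {j} → j < d → j < n
    <n j<d = <-≤-trans j<d (≤-trans (m≤m+n d d) d+d≤n)

SymsApart : List Triple → List Triple → Set
SymsApart xs ys = All (λ x → All (λ y → sym x ≢ sym y) ys) xs

symsApart : ∀ {P Q : Triple → Set} {xs ys} →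
  (∀ {x y} → P x → Q y → sym x ≢ sym y) → All P xs → All Q ys → SymsApart xs ys
symsApart apart Pxs Qys = All.map (λ px → All.map (apart px) Qys) Pxs

-- The construction

module Construction (n μ β I d : ℕ) .{{_ : NonZero n}}
  (n≡ : n ≡ 2 * (2 * β + 1) * I + (2 * β + 1) + 2 * d) (ts : ℕ → ℕ) (i₀ : Fin μ)
  (H₀ : InOmega n μ (2 * β + 1) d (ts 0))
  (H : ∀ k → 1 ≤ k → k ≤ 2 * I → InOmega n μ (2 * β + 1) 0 (ts k)) where

  open Placement n

  b K X : ℕ
  b = 2 * β + 1
  K = 2 * I
  X = b + d + I * b

  n≡X+d+I*b : n ≡ X + d + I * b
  n≡X+d+I*b = trans n≡ (regroup β I d)
    where
    regroup : ∀ β I d → 2 * (2 * β + 1) * I + (2 * β + 1) + 2 * d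
                      ≡ (2 * β + 1) + d + I * (2 * β + 1) + d + I * (2 * β + 1)
    regroup = solve-∀

  β+n≡ : β + n ≡ suc (3 * β + K * b + 2 * d)
  β+n≡ = trans (cong (β +_) n≡) (regroup β I d)
    where
    regroup : ∀ β I d → β + (2 * (2 * β + 1) * I + (2 * β + 1) + 2 * d)
                      ≡ suc (3 * β + 2 * I * (2 * β + 1) + 2 * d)
    regroup = solve-∀

  β+b≡ : β + b ≡ suc (3 * β)
  β+b≡ = regroup β
    where
    regroup : ∀ β → β + (2 * β + 1) ≡ suc (3 * β)
    regroup = solve-∀

  -- Block a < I sits right after the first square, block I + a right after the diagonal strip.
  data Half : ℕ → Set where
    lower : ∀ {a} → a < I → Half a
    upper : ∀ a → Half (I + a)

  half : ∀ a → Half a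
  half a with a <? I
  ... | yes a<I = lower a<I
  ... | no a≮I = subst Half (m+[n∸m]≡n (≮⇒≥ a≮I)) (upper (a ∸ I))

  upper<K⇒<I : ∀ {a} → I + a < K → a < I
  upper<K⇒<I {a} I+a<K = subst (a <_) (+-identityʳ I) (+-cancelˡ-< I a (I + 0) I+a<K)

  offset class : ℕ → ℕ
  offset a with half a
  ... | lower _ = b + d + a * b
  ... | upper a′ = X + d + a′ * b
  class a with half a
  ... | lower _ = 2 * suc a
  ... | upper a′ = suc (2 * a′)

  blocks-consecutive : ∀ c {a a′} → a < a′ → c + a * b + b ≤ c + a′ * b
  blocks-consecutive c {a} {a′} a<a′ = begin
    c + a * b + b    ≡⟨ +-assoc c (a * b) b ⟩
    c + (a * b + b)  ≡⟨ cong (c +_) (+-comm (a * b) b) ⟩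
    c + suc a * b    ≤⟨ +-monoʳ-≤ c (*-monoˡ-≤ b a<a′) ⟩
    c + a′ * b       ∎
    where open ≤-Reasoning

  offset-< : ∀ {a a′} → a < a′ → offset a + b ≤ offset a′
  offset-< {a} {a′} a<a′ with half a | half a′
  ... | lower _ | lower _ = blocks-consecutive (b + d) a<a′
  ... | lower a<I | upper a″ =
    ≤-trans (blocks-consecutive (b + d) a<I) (≤-trans (m≤m+n X d) (m≤m+n (X + d) (a″ * b)))
  ... | upper a₁ | lower a′<I = ⊥-elim (n≮n I (<-trans (≤-<-trans (m≤m+n I a₁) a<a′) a′<I))
  ... | upper a₁ | upper a₂ = blocks-consecutive (X + d) (+-cancelˡ-< I a₁ a₂ a<a′)

  offsets-separated : ∀ {a a′} → a ≢ a′ → offset a + b ≤ offset a′ ⊎ offset a′ + b ≤ offset a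
  offsets-separated {a} {a′} a≢a′ with <-cmp a a′
  ... | tri< a<a′ _ _ = inj₁ (offset-< a<a′)
  ... | tri≈ _ a≡a′ _ = ⊥-elim (a≢a′ a≡a′)
  ... | tri> _ _ a′<a = inj₂ (offset-< a′<a)

  core≤offset : ∀ a → b + d ≤ offset a
  core≤offset a with half a
  ... | lower _ = m≤m+n (b + d) (a * b)
  ... | upper a′ = ≤-trans (m≤m+n (b + d) (I * b)) (≤-trans (m≤m+n X d) (m≤m+n (X + d) (a′ * b)))

  diagonal-apart-offset : ∀ a → X + d ≤ offset a ⊎ offset a + b ≤ X
  diagonal-apart-offset a with half a
  ... | lower a<I = inj₂ (blocks-consecutive (b + d) a<I)
  ... | upper a′ = inj₁ (m≤m+n (X + d) (a′ * b))

  offset+b≤n : ∀ {a} → a < K → offset a + b ≤ n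
  offset+b≤n {a} a<K with half a
  ... | lower a<I = begin
    b + d + a * b + b  ≤⟨ blocks-consecutive (b + d) a<I ⟩
    X                  ≤⟨ m≤m+n X d ⟩
    X + d              ≤⟨ m≤m+n (X + d) (I * b) ⟩
    X + d + I * b      ≡⟨ n≡X+d+I*b ⟨
    n                  ∎
    where open ≤-Reasoning
  ... | upper a′ = ≤-trans (blocks-consecutive (X + d) (upper<K⇒<I a<K)) (≤-reflexive (≡.sym n≡X+d+I*b))

  1≤class : ∀ a → 1 ≤ class a
  1≤class a with half a
  ... | lower _ = s≤s z≤n
  ... | upper _ = s≤s z≤n

  class≤K : ∀ {a} → a < K → class a ≤ K
  class≤K {a} a<K with half a
  ... | lower a<I = *-monoʳ-≤ 2 a<I
  ... | upper a′ = *-monoʳ-< 2 (upper<K⇒<I a<K)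

  class-injective : ∀ a a′ → class a ≡ class a′ → a ≡ a′
  class-injective a a′ eq with half a | half a′
  ... | lower _ | lower _ = suc-injective (*-cancelˡ-≡ (suc a) (suc a′) 2 eq)
  ... | lower _ | upper a₂ = ⊥-elim (even≢odd (suc a) a₂ eq)
  ... | upper a₁ | lower _ = ⊥-elim (even≢odd (suc a′) a₁ (≡.sym eq))
  ... | upper a₁ | upper a₂ = cong (I +_) (*-cancelˡ-≡ a₁ a₂ 2 (suc-injective eq))

  sym-offset : ∀ a e → (e + 2 * offset a) % n ≡ (e + class a * b + 2 * d) % n
  sym-offset a e with half a
  ... | lower _ = cong (_% n) (regroup e β d a)
    where
    regroup : ∀ e β d a → e + 2 * ((2 * β + 1) + d + a * (2 * β + 1))
                        ≡ e + 2 * (1 + a) * (2 * β + 1) + 2 * d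
    regroup = solve-∀
  ... | upper a′ = begin
    (e + 2 * (X + d + a′ * b)) % n                   ≡⟨ cong (_% n) (regroup e β d I a′) ⟩
    (e + suc (2 * a′) * b + 2 * d + (2 * b * I + b + 2 * d)) % n
                                                     ≡⟨ cong (λ m → (e + suc (2 * a′) * b + 2 * d + m) % n) n≡ ⟨
    (e + suc (2 * a′) * b + 2 * d + n) % n           ≡⟨ [m+n]%n≡m%n (e + suc (2 * a′) * b + 2 * d) n ⟩
    (e + suc (2 * a′) * b + 2 * d) % n               ∎
    where
    open ≡.≡-Reasoning
    regroup : ∀ e β d I a → e + 2 * ((2 * β + 1) + d + I * (2 * β + 1) + d + a * (2 * β + 1))
                          ≡ e + (1 + 2 * a) * (2 * β + 1) + 2 * d + (2 * (2 * β + 1) * I + (2 * β + 1) + 2 * d)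
    regroup = solve-∀

  T₀ : Family μ
  T₀ = proj₁ H₀

  T₀-partial : ∀ i → PartialTransversal n (b + d) (T₀ i)
  T₀-partial = proj₁ (proj₂ H₀)

  T₀-allowed : ∀ i → All (AllowedSym b d ∘ sym) (T₀ i)
  T₀-allowed = proj₁ (proj₂ (proj₂ H₀))

  blockData : (a : Fin K) → InOmega n μ b 0 (ts (suc (toℕ a)))
  blockData a = H (suc (toℕ a)) (s≤s z≤n) (toℕ<n a)

  blockFamily : Fin K → Family μ
  blockFamily a = proj₁ (blockData a)

  blockFamily-partial : ∀ a i → PartialTransversal n b (blockFamily a i)
  blockFamily-partial a i =
    subst (λ w → PartialTransversal n w (blockFamily a i)) (+-identityʳ b) (proj₁ (proj₂ (blockData a)) i)

  blockFamily-allowed : ∀ a i → All (AllowedSym b 0 ∘ sym) (blockFamily a i)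
  blockFamily-allowed a = proj₁ (proj₂ (proj₂ (blockData a)))

  diagonalPiece corePiece : Piece μ
  diagonalPiece = shiftPiece X (piece (λ _ → diagonal d) 0 d d)
  corePiece = piece T₀ 0 (b + d) (ts 0)

  blockPiece : Fin K → Piece μ
  blockPiece a = shiftPiece (offset (toℕ a)) (piece (blockFamily a) 0 b (ts (suc (toℕ a))))

  pieces : List (Piece μ)
  pieces = diagonalPiece ∷ corePiece ∷ tabulate blockPiece

  all-pieces : ∀ {P : Piece μ → Set} →
    P diagonalPiece → P corePiece → (∀ a → P (blockPiece a)) → All P pieces
  all-pieces P-diagonal P-core P-block = P-diagonal ∷ P-core ∷ Allₚ.tabulate⁺ P-block

  allPairs-pieces : ∀ {R : Piece μ → Piece μ → Set} →
    R diagonalPiece corePiece → (∀ a → R diagonalPiece (blockPiece a)) →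
    (∀ a → R corePiece (blockPiece a)) → (∀ {a a′} → a ≢ a′ → R (blockPiece a) (blockPiece a′)) →
    AllPairs R pieces
  allPairs-pieces R-diagonal-core R-diagonal-block R-core-block R-block-block =
    (R-diagonal-core ∷ Allₚ.tabulate⁺ R-diagonal-block) ∷
    Allₚ.tabulate⁺ R-core-block ∷ AllPairsₚ.tabulate⁺ R-block-block

  pieces-placed : All (Placed n) pieces
  pieces-placed = all-pieces
    (shiftPiece-placed X i₀ X+d≤n (partialTransversal-placed (λ _ → diagonal-pt)
      (stablyIntersect-const i₀ (partialTransversal-unique diagonal-pt) (proj₁ diagonal-pt))))
    (partialTransversal-placed T₀-partial (proj₂ (proj₂ (proj₂ H₀))))
    (λ a → shiftPiece-placed (offset (toℕ a)) i₀ (offset+b≤n (toℕ<n a))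
             (partialTransversal-placed (blockFamily-partial a) (proj₂ (proj₂ (proj₂ (blockData a))))))
    where
    X+d≤n : X + d ≤ n
    X+d≤n = ≤-trans (m≤m+n (X + d) (I * b)) (≤-reflexive (≡.sym n≡X+d+I*b))
    diagonal-pt : PartialTransversal n d (diagonal d)
    diagonal-pt = diagonal-partialTransversal
      (≤-trans (+-monoˡ-≤ d (≤-trans (m≤n+m d b) (m≤m+n (b + d) (I * b)))) X+d≤n)

  pieces-separated : AllPairs Separated pieces
  pieces-separated = allPairs-pieces
    (inj₂ (m≤m+n (b + d) (I * b)))
    (λ a → diagonal-apart-offset (toℕ a))
    (λ a → inj₁ (core≤offset (toℕ a)))
    (λ a≢a′ → offsets-separated (a≢a′ ∘ toℕ-injective))

  pieces-size : sum (map size pieces) ≡ n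
  pieces-size = begin
    d + (b + d + sum (map size (tabulate blockPiece)))
      ≡⟨ cong (λ bs → d + (b + d + sum bs))
              (trans (map-tabulate blockPiece size) (tabulate-toℕ K (λ _ → b))) ⟩
    d + (b + d + sum (applyUpTo (λ _ → b) K))
      ≡⟨ cong (λ s → d + (b + d + s)) (sum-applyUpTo-const K b) ⟩
    d + (b + d + K * b)
      ≡⟨ trans (regroup β I d) (≡.sym n≡) ⟩
    n ∎
    where
    open ≡.≡-Reasoning
    regroup : ∀ β I d → d + ((2 * β + 1) + d + 2 * I * (2 * β + 1))
                      ≡ 2 * (2 * β + 1) * I + (2 * β + 1) + 2 * d
    regroup = solve-∀

  pieces-common : sum (map common pieces) ≡ d + sum (map ts (upTo (suc K)))
  pieces-common = cong (λ cs → d + (ts 0 + sum cs))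
    (trans (map-tabulate blockPiece common)
      (trans (tabulate-toℕ K (ts ∘ suc)) (≡.sym (map-applyUpTo suc ts K))))

  allowed-bounds : ∀ {dbar e} → AllowedSym b dbar e → β ≤ e × e ≤ 3 * β + 2 * dbar
  allowed-bounds {dbar} {e} (lo , hi , _) =
    subst (_≤ e) half≡β lo , subst (λ m → e ≤ m + 2 * dbar) three-halves≡3β hi
    where
    b∸1≡ : b ∸ 1 ≡ 2 * β
    b∸1≡ = m+n∸n≡m (2 * β) 1
    half≡β : (b ∸ 1) / 2 ≡ β
    half≡β = trans (cong (_/ 2) (trans b∸1≡ (*-comm 2 β))) (m*n/n≡m β 2)
    three-halves≡3β : (3 * (b ∸ 1)) / 2 ≡ 3 * β
    three-halves≡3β =
      trans (cong (λ m → (3 * m) / 2) b∸1≡) (trans (cong (_/ 2) (regroup β)) (m*n/n≡m (3 * β) 2))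
      where
      regroup : ∀ β → 3 * (2 * β) ≡ 3 * β * 2
      regroup = solve-∀

  -- Symbols are compared through representatives in [β, β + n), where reduction mod n is injective.
  record Lift (x : Triple) (v : ℕ) : Set where
    constructor lift
    field
      window : InWindow β n v
      sym≡   : sym x ≡ v % n

  lift-unique : ∀ {x y v w} → Lift x v → Lift y w → sym x ≡ sym y → v ≡ w
  lift-unique (lift v∈ x≡) (lift w∈ y≡) eq = %-injective-window v∈ w∈ (trans (≡.sym x≡) (trans eq y≡))

  LowLift : Triple → Set
  LowLift x = ∃ λ v → v ≤ 3 * β + 2 * d × Lift x v

  HighLift : ℕ → Triple → Set
  HighLift a x = ∃ λ e → InWindow β b e × Lift x (e + class a * b + 2 * d)

  low-window : ∀ {v} → β ≤ v → v ≤ 3 * β + 2 * d → InWindow β n v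
  low-window {v} β≤v v≤ =
    β≤v , subst (v <_) (≡.sym β+n≡) (s≤s (≤-trans v≤ (+-monoˡ-≤ (2 * d) (m≤m+n (3 * β) (K * b)))))

  high-window : ∀ {a e} → a < K → InWindow β b e → InWindow β n (e + class a * b + 2 * d)
  high-window {a} {e} a<K (β≤e , e<β+b) =
    ≤-trans β≤e (≤-trans (m≤m+n e _) (m≤m+n _ (2 * d))) ,
    subst (e + class a * b + 2 * d <_) (≡.sym β+n≡)
      (s≤s (+-monoˡ-≤ (2 * d) (+-mono-≤ e≤3β (*-monoˡ-≤ b (class≤K a<K)))))
    where
    e≤3β : e ≤ 3 * β
    e≤3β = ≤-pred (subst (e <_) β+b≡ e<β+b)

  low-high : ∀ {a x y} → LowLift x → HighLift a y → sym x ≢ sym y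
  low-high {a} (v , v≤ , x↑) (e , (β≤e , _) , y↑) eq = <⇒≢ v<lift (lift-unique x↑ y↑ eq)
    where
    open ≤-Reasoning
    regroup : ∀ β → suc (3 * β) ≡ β + 1 * (2 * β + 1)
    regroup = solve-∀
    v<lift : v < e + class a * b + 2 * d
    v<lift = begin-strict
      v                        ≤⟨ v≤ ⟩
      3 * β + 2 * d            <⟨ +-monoˡ-< (2 * d) (≤-reflexive (regroup β)) ⟩
      β + 1 * b + 2 * d        ≤⟨ +-monoˡ-≤ (2 * d) (+-mono-≤ β≤e (*-monoˡ-≤ b (1≤class a))) ⟩
      e + class a * b + 2 * d  ∎

  high-high : ∀ {a a′ x y} → a ≢ a′ → HighLift a x → HighLift a′ y → sym x ≢ sym y
  high-high a≢a′ (e , e∈ , x↑) (e′ , e′∈ , y↑) eq =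
    a≢a′ (class-injective _ _ (window-quotient-unique e∈ e′∈ (+-cancelʳ-≡ (2 * d) _ _ (lift-unique x↑ y↑ eq))))

  diagonal-bound : ∀ {j} → j < d → b + 2 * j ≤ 3 * β + 2 * d
  diagonal-bound {j} j<d = ≤-pred (begin
    suc (b + 2 * j)  ≤⟨ +-monoʳ-< b (*-monoʳ-< 2 j<d) ⟩
    b + 2 * d        ≤⟨ m≤m+n (b + 2 * d) β ⟩
    b + 2 * d + β    ≡⟨ regroup β d ⟩
    suc (3 * β + 2 * d) ∎)
    where
    open ≤-Reasoning
    regroup : ∀ β d → (2 * β + 1) + 2 * d + β ≡ suc (3 * β + 2 * d)
    regroup = solve-∀

  -- The diagonal strip starts at X = (n + b)/2, so its symbol 2(X + j) is b + 2j modulo n.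
  diagonal-lift : ∀ {j} → j < d → Lift (shift X (cell j j)) (b + 2 * j)
  diagonal-lift {j} j<d = lift
    (low-window (≤-trans (m≤m+n β (β + 0)) (≤-trans (m≤m+n (2 * β) 1) (m≤m+n b (2 * j))))
                (diagonal-bound j<d))
    (begin
      (j + X + (j + X)) % n                               ≡⟨ cong (_% n) (regroup j β d I) ⟩
      (b + 2 * j + (2 * b * I + b + 2 * d)) % n           ≡⟨ cong (λ m → (b + 2 * j + m) % n) n≡ ⟨
      (b + 2 * j + n) % n                                 ≡⟨ [m+n]%n≡m%n (b + 2 * j) n ⟩
      (b + 2 * j) % n                                     ∎)
    where
    open ≡.≡-Reasoning
    regroup : ∀ j β d I →
      j + ((2 * β + 1) + d + I * (2 * β + 1)) + (j + ((2 * β + 1) + d + I * (2 * β + 1)))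
        ≡ (2 * β + 1) + 2 * j + (2 * (2 * β + 1) * I + (2 * β + 1) + 2 * d)
    regroup = solve-∀

  diagonal-low : ∀ i → All LowLift (cells diagonalPiece i)
  diagonal-low i = Allₚ.map⁺ (Allₚ.applyUpTo⁺₁ _ d λ j<d → _ , diagonal-bound j<d , diagonal-lift j<d)

  diagonal-syms : ∀ i → Distinct sym (cells diagonalPiece i)
  diagonal-syms i = AllPairsₚ.map⁺ (AllPairsₚ.applyUpTo⁺₁ _ d λ j<j′ j′<d eq →
    <⇒≢ (+-monoʳ-< b (*-monoʳ-< 2 j<j′))
        (lift-unique (diagonal-lift (<-trans j<j′ j′<d)) (diagonal-lift j′<d) eq))

  core-lift : ∀ {y} → InB n y → AllowedSym b d (sym y) → Lift y (sym y)
  core-lift inB allowed = lift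
    (low-window (proj₁ (allowed-bounds allowed)) (proj₂ (allowed-bounds allowed)))
    (≡.sym (m<n⇒m%n≡m (InB⇒sym<n inB)))

  core-cells : ∀ i → All (λ y → InB n y × AllowedSym b d (sym y)) (T₀ i)
  core-cells i = All.zip (proj₁ (proj₂ (T₀-partial i)) , T₀-allowed i)

  core-low : ∀ i → All LowLift (T₀ i)
  core-low i = All.map (λ {y} (inB , allowed) → sym y , proj₂ (allowed-bounds allowed) , core-lift inB allowed)
                       (core-cells i)

  core-syms : ∀ i → Distinct sym (T₀ i)
  core-syms i = let (_ , _ , _ , _ , _ , syms) = T₀-partial i in AllPairsₚ.map⁻ syms

  diagonal-core : ∀ i → SymsApart (cells diagonalPiece i) (T₀ i)
  diagonal-core i = Allₚ.map⁺ (Allₚ.applyUpTo⁺₁ _ d λ {j} j<d →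
    All.map (λ (inB , allowed) eq →
               proj₂ (proj₂ allowed) j j<d (≡.sym (lift-unique (diagonal-lift j<d) (core-lift inB allowed) eq)))
            (core-cells i))

  BlockLift : Fin K → Triple → Set
  BlockLift a y =
    InWindow β b (sym y) × Lift (shift (offset (toℕ a)) y) (sym y + class (toℕ a) * b + 2 * d)

  block-lift : ∀ a i → All (BlockLift a) (blockFamily a i)
  block-lift a i = All.zipWith lift-cell
    ( proj₁ (proj₂ (blockFamily-partial a i))
    , All.zip (proj₁ (proj₂ (proj₂ (blockFamily-partial a i))) , blockFamily-allowed a i))
    where
    lift-cell : ∀ {y} → InB n y × (row y < b × col y < b) × AllowedSym b 0 (sym y) → BlockLift a y
    lift-cell {y} (inB , (r<b , c<b) , allowed) =
      e∈ , lift (high-window (toℕ<n a) e∈)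
                (trans (sym-shift (offset (toℕ a)) inB r+c<n) (sym-offset (toℕ a) (sym y)))
      where
      e∈ : InWindow β b (sym y)
      e∈ = proj₁ (allowed-bounds allowed) , subst (sym y <_) (≡.sym β+b≡)
             (s≤s (subst (sym y ≤_) (+-identityʳ (3 * β)) (proj₂ (allowed-bounds allowed))))
      r+c<n : row y + col y < n
      r+c<n = <-≤-trans (+-mono-< r<b c<b)
                (≤-trans (+-monoˡ-≤ b (≤-trans (m≤m+n b d) (core≤offset (toℕ a)))) (offset+b≤n (toℕ<n a)))

  block-syms : ∀ a i → Distinct sym (cells (blockPiece a) i)
  block-syms a i = AllPairsₚ.map⁺ (AllPairs-mapOn distinct-lifts (block-lift a i)
    (let (_ , _ , _ , _ , _ , syms) = blockFamily-partial a i in AllPairsₚ.map⁻ syms))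
    where
    distinct-lifts : ∀ {y y′} → BlockLift a y → BlockLift a y′ → sym y ≢ sym y′ →
      sym (shift (offset (toℕ a)) y) ≢ sym (shift (offset (toℕ a)) y′)
    distinct-lifts (_ , y↑) (_ , y′↑) sy≢ eq =
      sy≢ (+-cancelʳ-≡ _ _ _ (+-cancelʳ-≡ (2 * d) _ _ (lift-unique y↑ y′↑ eq)))

  block-high : ∀ a i → All (HighLift (toℕ a)) (cells (blockPiece a) i)
  block-high a i = Allₚ.map⁺ (All.map (λ {y} (e∈ , y↑) → sym y , e∈ , y↑) (block-lift a i))

  syms-distinct : ∀ i → Distinct sym (glue pieces i)
  syms-distinct i = AllPairsₚ.concat⁺
    (Allₚ.map⁺ {f = cellsAt} (all-pieces (diagonal-syms i) (core-syms i) (λ a → block-syms a i)))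
    (AllPairsₚ.map⁺ {f = cellsAt} (allPairs-pieces (diagonal-core i)
      (λ a → symsApart low-high (diagonal-low i) (block-high a i))
      (λ a → symsApart low-high (core-low i) (block-high a i))
      (λ a≢a′ → symsApart (high-high (a≢a′ ∘ toℕ-injective)) (block-high _ i) (block-high _ i))))
    where
    cellsAt : Piece μ → List Triple
    cellsAt p = cells p i

theorem4 : (n b μ : ℕ) → .{{_ : NonZero n}} →
    Odd n → Odd b → 3 ≤ b → 3 * b ≤ n → 2 ≤ μ →
    (I d : ℕ) → 1 ≤ I → d ≤ b ∸ 1 → n ≡ 2 * b * I + b + 2 * d →
    (ts : ℕ → ℕ) →
    InOmega n μ b d (ts 0) →
    (∀ i → 1 ≤ i → i ≤ 2 * I → InOmega n μ b 0 (ts i)) →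
    Σ (Fin μ → List Triple) λ T →
      (∀ i → Transversal n (T i)) ×
      StablyIntersect μ T (d + sum (map ts (upTo (suc (2 * I)))))
theorem4 n b μ _ (β , refl) _ _ (s≤s _) I d _ _ n≡ ts H₀ H =
  glue pieces ,
  glue-transversal pieces-placed pieces-separated pieces-size syms-distinct ,
  subst (StablyIntersect μ (glue pieces)) pieces-common
    (glue-stablyIntersect Fin.zero pieces-placed pieces-separated)
  where open Construction n μ β I d n≡ ts Fin.zero H₀ H
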